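{- If $G$ is a connected graph that is a proper interval $k$-graph or a unit interval $k$-graph, then $G$ has a dominating pair of vertices.
   Context: All graphs are finite and simple. A graph $G$ is an interval $k$-graph if there is a one-to-one correspondence $v\mapsto I_v$ between $V(G)$ and a family of closed intervals of the real line, together with a partition of the family into at most $k$ classes, such that distinct vertices $u,v$ are adjacent if and only if $I_u\cap I_v\neq\emptyset$ and $I_u,I_v$ lie in different classes. $G$ is a proper interval $k$-graph if it has such a representation in which no interval properly contains another, and a unit interval $k$-graph if it has such a representation in which all intervals have the same length. A dominating pair is a pair of vertices $u,v$ such that there is a $u,v$-path $P$ in $G$ with every vertex of $G$ either on $P$ or adjacent to a vertex of $P$.
   Formalization: The intervals in a proper or unit interval $k$-graph representation have rational endpoints instead of real ones. -}

module Defs where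

open import Data.Nat using (ℕ; suc)
open import Data.Fin using (Fin)
open import Data.Rational using (ℚ; _≤_; _-_)
open import Data.Product using (Σ; ∃; _×_)
open import Data.Sum using (_⊎_)
open import Data.List using (List; []; _∷_)
open import Data.List.Membership.Propositional using (_∈_)
open import Data.List.Relation.Unary.Any using (Any)
open import Data.List.Relation.Unary.Unique.Propositional using (Unique)
open import Relation.Binary.PropositionalEquality using (_≡_; _≢_)
open import Relation.Nullary using (¬_)
open import Function.Bundles using (_⇔_)
open import Level using (0ℓ) renaming (suc to lsuc)

record Graph : Set₁ where
  field
    n     : ℕ
    Adj   : Fin n → Fin n → Set
    sym   : ∀ {u v} → Adj u v → Adj v u
    irrefl : ∀ {u} → ¬ Adj u u

module _ (G : Graph) where
  open Graph G

  data Walk : Fin n → Fin n → List (Fin n) → Set where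
    here : ∀ {u} → Walk u u (u ∷ [])
    step : ∀ {u w v vs} → Adj u w → Walk w v vs → Walk u v (u ∷ vs)

  Path : Fin n → Fin n → List (Fin n) → Set
  Path u v vs = Walk u v vs × Unique vs

  -- Connected: nonempty, and any two vertices are joined by a path.
  Connected : Set
  Connected = Fin n × (∀ u v → ∃ λ vs → Path u v vs)

  DominatingPair : Fin n → Fin n → Set
  DominatingPair u v =
    ∃ λ vs → Path u v vs × (∀ x → x ∈ vs ⊎ Any (Adj x) vs)

  HasDominatingPair : Set
  HasDominatingPair = Σ (Fin n) λ u → Σ (Fin n) λ v → DominatingPair u v

  record IntervalRep (k : ℕ) : Set where
    field
      l r   : Fin n → ℚ
      l≤r   : ∀ v → l v ≤ r v
      c     : Fin n → Fin k
      inj   : ∀ u v → l u ≡ l v → r u ≡ r v → u ≡ v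
      adj⇔  : ∀ u v → u ≢ v →
              Adj u v ⇔ ((l u ≤ r v × l v ≤ r u) × c u ≢ c v)

    ProperlyContains : Fin n → Fin n → Set
    ProperlyContains u v =
      (l u ≤ l v × r v ≤ r u) × (l u ≢ l v ⊎ r u ≢ r v)

    Proper : Set
    Proper = ∀ u v → ¬ ProperlyContains u v

    Unit : Set
    Unit = ∀ u v → r u - l u ≡ r v - l v

  ProperIntervalKGraph : ℕ → Set
  ProperIntervalKGraph k = Σ (IntervalRep k) IntervalRep.Proper

  UnitIntervalKGraph : ℕ → Set
  UnitIntervalKGraph k = Σ (IntervalRep k) IntervalRep.Unit

{-# OPTIONS --safe #-}
-- Ordering the vertices of a proper (in particular unit) interval representation by
-- left endpoints also orders their right endpoints.  Let u and v have the leftmost and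
-- rightmost left endpoints; then every u,v-path P dominates G.  For x off P, some edge
-- aw of P has l a ≤ l x ≤ l w, so I_x meets both I_a and I_w; as a and w lie in
-- different classes, x lies in a class different from at least one of them.
module Submission where

open import Defs
open import Data.Nat using (ℕ)
open import Data.Empty using (⊥-elim)
open import Data.Fin using (Fin) renaming (_≟_ to _≟ᶠ_)
open import Data.List using (List; allFin)
open import Data.List.Membership.Propositional using (_∈_; lose)
open import Data.List.Membership.Propositional.Properties using (∈-allFin)
open import Data.List.Relation.Unary.All as All using ()
open import Data.List.Relation.Unary.Any using (Any; here; there)
open import Data.Product using (_×_; _,_; proj₁; proj₂)
open import Data.Rational using (_≤_; _-_; _+_)
open import Data.Rational.Properties
  using ( ≤-trans; ≤-reflexive; ≤-antisym; _≤?_; ≰⇒>; <⇒≤; <⇒≢; +-monoʳ-≤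
        ; ≤-decTotalOrder; +-0-group; module ≤-Reasoning)
open import Data.Sum using (_⊎_; inj₁; inj₂; [_,_]′) renaming (map to ⊎-map)
open import Function using (_∘_)
open import Function.Bundles using (Equivalence)
open import Relation.Binary.Bundles using (DecTotalOrder)
open import Relation.Binary.PropositionalEquality using (_≡_; _≢_; refl; sym; trans; cong)
open import Relation.Nullary using (yes; no)

open import Algebra.Properties.Group +-0-group using () renaming (//-rightDividesˡ to p-q+q≡p)
open import Data.List.Extrema (DecTotalOrder.totalOrder ≤-decTotalOrder)
  using (argmin; argmax; f[argmin]≤f[xs]; f[xs]≤f[argmax])

module _ {k : ℕ} {G : Graph} (R : IntervalRep G k) where
  open IntervalRep R

  RightEndpointMonotone : Set
  RightEndpointMonotone = ∀ u v → l u ≤ l v → r u ≤ r v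

  proper⇒rightEndpointMonotone : Proper → RightEndpointMonotone
  proper⇒rightEndpointMonotone proper u v lu≤lv with r u ≤? r v
  ... | yes ru≤rv = ru≤rv
  ... | no ru≰rv =
    ⊥-elim (proper u v ((lu≤lv , <⇒≤ (≰⇒> ru≰rv)) , inj₂ (<⇒≢ (≰⇒> ru≰rv) ∘ sym)))

  unit⇒rightEndpointMonotone : Unit → RightEndpointMonotone
  unit⇒rightEndpointMonotone unit u v lu≤lv = begin
    r u               ≡⟨ sym (p-q+q≡p (l u) (r u)) ⟩
    r u - l u + l u   ≡⟨ cong (_+ l u) (unit u v) ⟩
    r v - l v + l u   ≤⟨ +-monoʳ-≤ (r v - l v) lu≤lv ⟩
    r v - l v + l v   ≡⟨ p-q+q≡p (l v) (r v) ⟩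
    r v               ∎
    where open ≤-Reasoning

module _ {G : Graph} where
  open Graph G using (n; Adj; irrefl)

  Dominated : List (Fin n) → Fin n → Set
  Dominated vs x = x ∈ vs ⊎ Any (Adj x) vs

  walk-start∈ : ∀ {u v vs} → Walk G u v vs → u ∈ vs
  walk-start∈ here       = here refl
  walk-start∈ (step _ _) = here refl

  adj⇒≢ : ∀ {u v} → Adj u v → u ≢ v
  adj⇒≢ u~v refl = irrefl u~v

  module _ {k : ℕ} (R : IntervalRep G k) (monotone : RightEndpointMonotone R) where
    open IntervalRep R

    l-injective : ∀ {u v} → l u ≡ l v → u ≡ v
    l-injective {u} {v} lu≡lv = inj u v lu≡lv
      (≤-antisym (monotone u v (≤-reflexive lu≡lv)) (monotone v u (≤-reflexive (sym lu≡lv))))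

    adj⇒meet : ∀ {u v} → Adj u v → l u ≤ r v × l v ≤ r u
    adj⇒meet u~v = proj₁ (Equivalence.to (adj⇔ _ _ (adj⇒≢ u~v)) u~v)

    adj⇒class≢ : ∀ {u v} → Adj u v → c u ≢ c v
    adj⇒class≢ u~v = proj₂ (Equivalence.to (adj⇔ _ _ (adj⇒≢ u~v)) u~v)

    meet⇒adj : ∀ {u v} → u ≢ v → l u ≤ r v → l v ≤ r u → c u ≢ c v → Adj u v
    meet⇒adj u≢v lu≤rv lv≤ru cu≢cv = Equivalence.from (adj⇔ _ _ u≢v) ((lu≤rv , lv≤ru) , cu≢cv)

    between-edge⇒adj : ∀ {a w x} → Adj a w → l a ≤ l x → l x ≤ l w → x ≢ a → x ≢ w →
                       Adj x a ⊎ Adj x w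
    between-edge⇒adj {a} {w} {x} a~w la≤lx lx≤lw x≢a x≢w with c x ≟ᶠ c a
    ... | no cx≢ca = inj₁
      (meet⇒adj x≢a (≤-trans lx≤lw (proj₂ (adj⇒meet a~w))) (≤-trans la≤lx (l≤r x)) cx≢ca)
    ... | yes cx≡ca = inj₂
      (meet⇒adj x≢w (≤-trans lx≤lw (l≤r w)) (≤-trans (proj₂ (adj⇒meet a~w)) (monotone a x la≤lx))
                λ cx≡cw → adj⇒class≢ a~w (trans (sym cx≡ca) cx≡cw))

    walk-dominates-between : ∀ {a v vs} x → Walk G a v vs → l a ≤ l x → l x ≤ l v → Dominated vs x
    walk-dominates-between x here la≤lx lx≤la = inj₁ (here (l-injective (≤-antisym lx≤la la≤lx)))
    walk-dominates-between {a} x (step {w = w} a~w walk) la≤lx lx≤lv with l x ≤? l w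
    ... | no lx≰lw = ⊎-map there there (walk-dominates-between x walk (<⇒≤ (≰⇒> lx≰lw)) lx≤lv)
    ... | yes lx≤lw with x ≟ᶠ a | x ≟ᶠ w
    ...   | yes refl | _        = inj₁ (here refl)
    ...   | no _     | yes refl = inj₁ (there (walk-start∈ walk))
    ...   | no x≢a   | no x≢w   =
      inj₂ ([ here , there ∘ lose (walk-start∈ walk) ]′ (between-edge⇒adj a~w la≤lx lx≤lw x≢a x≢w))

    connected⇒dominatingPair : Connected G → HasDominatingPair G
    connected⇒dominatingPair (v₀ , connected) =
      let vs , path = connected leftmost rightmost
      in leftmost , rightmost , vs , path ,
         λ x → walk-dominates-between x (proj₁ path) (leftmost≤ x) (≤rightmost x)
      where
      leftmost rightmost : Fin n
      leftmost  = argmin l v₀ (allFin n)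
      rightmost = argmax l v₀ (allFin n)

      leftmost≤ : ∀ x → l leftmost ≤ l x
      leftmost≤ x = All.lookup (f[argmin]≤f[xs] v₀ (allFin n)) (∈-allFin x)

      ≤rightmost : ∀ x → l x ≤ l rightmost
      ≤rightmost x = All.lookup (f[xs]≤f[argmax] v₀ (allFin n)) (∈-allFin x)

theorem3p2 : (k : ℕ) (G : Graph) → Connected G →
    ProperIntervalKGraph G k ⊎ UnitIntervalKGraph G k →
    HasDominatingPair G
theorem3p2 k G connected (inj₁ (R , proper)) =
  connected⇒dominatingPair R (proper⇒rightEndpointMonotone R proper) connected
theorem3p2 k G connected (inj₂ (R , unit)) =
  connected⇒dominatingPair R (unit⇒rightEndpointMonotone R unit) connected
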